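{- Let $H$ be a graph with $O(n)$ nodes and $O(n)$ edges (i.e., for a fixed constant $c_0>0$, at most $c_0 n$ nodes and at most $c_0 n$ edges, and $n$ sufficiently large). Then there exists an integer $k$ with $n^{0.6}\leq k\leq n^{0.7}$ such that $H$ does not contain any node of degree $k$ or $k-1$. -}

module Defs where

open import Data.Nat using (ℕ; zero; suc; _+_; _<ᵇ_)
open import Data.Fin using (Fin; zero; suc; toℕ)
open import Data.Bool using (Bool; true; false; if_then_else_; _∧_)
open import Relation.Binary.PropositionalEquality using (_≡_)

count : (n : ℕ) → (Fin n → Bool) → ℕ
count zero    p = 0
count (suc n) p = (if p zero then 1 else 0) + count n (λ i → p (suc i))

sumFin : (n : ℕ) → (Fin n → ℕ) → ℕ
sumFin zero    f = 0
sumFin (suc n) f = f zero + sumFin n (λ i → f (suc i))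

record Graph : Set where
  field
    V     : ℕ
    adj   : Fin V → Fin V → Bool
    sym   : ∀ i j → adj i j ≡ adj j i
    irrefl : ∀ i → adj i i ≡ false

open Graph public

nodes : Graph → ℕ
nodes H = V H

degree : (H : Graph) → Fin (V H) → ℕ
degree H v = count (V H) (adj H v)

edges : Graph → ℕ
edges H = sumFin (V H) (λ i → count (V H) (λ j → (toℕ i <ᵇ toℕ j) ∧ adj H i j))

-- Let s = ⌊n^(1/20)⌋ and a = (s+1)^12, and consider the s^13 candidates k = a + 2j, j < s^13,
-- whose windows {k - 1, k} are pairwise disjoint.  A node of degree d lies in at most one
-- window, and only if d ≥ a - 1, so a node blocking some candidate contributes at least a - 1
-- to the degree sum.  If every candidate were blocked, double counting and the handshake lemma
-- would give s^13 (a - 1) ≤ 2 |E| ≤ 2 c₀ n = O(s^20), which fails once s^5 is large.  The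
-- range of candidates fits in [n^0.6, n^0.7]: a^5 = (s+1)^60 > n^3 and (a + 2 s^13)^10 ≤ s^140 ≤ n^7.
module Submission where

open import Defs hiding (sym)
open import Data.Nat
  using (ℕ; zero; suc; _+_; _*_; _^_; _∸_; _≤_; _<_; _<ᵇ_; z≤n; s≤s; s≤s⁻¹; _≟_; _<?_;
         NonZero; >-nonZero)
open import Data.Nat.Properties
open import Data.Nat.Solver using (module +-*-Solver)
open import Data.Fin using (Fin; toℕ) renaming (zero to fzero; suc to fsuc)
open import Data.Fin.Properties using (toℕ-injective; toℕ<n)
open import Data.Bool using (Bool; true; false; if_then_else_; _∧_; _∨_; T)
open import Data.Product using (∃-syntax; _×_; _,_)
open import Data.Sum using (_⊎_; inj₁; inj₂)
open import Relation.Nullary using (yes; no; contradiction)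
open import Relation.Nullary.Decidable using (⌊_⌋)
open import Relation.Binary.PropositionalEquality
  using (_≡_; _≢_; refl; sym; trans; cong; cong₂; subst; module ≡-Reasoning)

indicator : Bool → ℕ
indicator b = if b then 1 else 0

sumFin-cong : ∀ n {f g : Fin n → ℕ} → (∀ i → f i ≡ g i) → sumFin n f ≡ sumFin n g
sumFin-cong zero    f≗g = refl
sumFin-cong (suc n) f≗g = cong₂ _+_ (f≗g fzero) (sumFin-cong n (λ i → f≗g (fsuc i)))

sumFin-mono-≤ : ∀ n {f g : Fin n → ℕ} → (∀ i → f i ≤ g i) → sumFin n f ≤ sumFin n g
sumFin-mono-≤ zero    f≤g = z≤n
sumFin-mono-≤ (suc n) f≤g = +-mono-≤ (f≤g fzero) (sumFin-mono-≤ n (λ i → f≤g (fsuc i)))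

sumFin-distrib-+ : ∀ n (f g : Fin n → ℕ) →
                   sumFin n (λ i → f i + g i) ≡ sumFin n f + sumFin n g
sumFin-distrib-+ zero    f g = refl
sumFin-distrib-+ (suc n) f g = begin
  f fzero + g fzero + sumFin n (λ i → f (fsuc i) + g (fsuc i))
    ≡⟨ cong (f fzero + g fzero +_) (sumFin-distrib-+ n (λ i → f (fsuc i)) (λ i → g (fsuc i))) ⟩
  f fzero + g fzero + (F + G)
    ≡⟨ +-*-Solver.solve 4 (λ x y X Y → x :+ y :+ (X :+ Y) := x :+ X :+ (y :+ Y))
                          refl (f fzero) (g fzero) F G ⟩
  f fzero + F + (g fzero + G) ∎
  where
  open ≡-Reasoning
  open +-*-Solver using (_:+_; _:=_)
  F = sumFin n (λ i → f (fsuc i))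
  G = sumFin n (λ i → g (fsuc i))

sumFin-distribʳ-* : ∀ n (f : Fin n → ℕ) c → sumFin n f * c ≡ sumFin n (λ i → f i * c)
sumFin-distribʳ-* zero    f c = refl
sumFin-distribʳ-* (suc n) f c =
  trans (*-distribʳ-+ c (f fzero) _) (cong (f fzero * c +_) (sumFin-distribʳ-* n _ c))

sumFin-zero : ∀ n → sumFin n (λ _ → 0) ≡ 0
sumFin-zero zero    = refl
sumFin-zero (suc n) = sumFin-zero n

sumFin-swap : ∀ m n (f : Fin m → Fin n → ℕ) →
              sumFin m (λ i → sumFin n (f i)) ≡ sumFin n (λ j → sumFin m (λ i → f i j))
sumFin-swap zero    n f = sym (sumFin-zero n)
sumFin-swap (suc m) n f =
  trans (cong (sumFin n (f fzero) +_) (sumFin-swap m n (λ i → f (fsuc i))))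
        (sym (sumFin-distrib-+ n (f fzero) (λ j → sumFin m (λ i → f (fsuc i) j))))

count≡sumFin-indicator : ∀ n (p : Fin n → Bool) → count n p ≡ sumFin n (λ i → indicator (p i))
count≡sumFin-indicator zero    p = refl
count≡sumFin-indicator (suc n) p = cong (indicator (p fzero) +_) (count≡sumFin-indicator n _)

count-cong : ∀ n {p q : Fin n → Bool} → (∀ i → p i ≡ q i) → count n p ≡ count n q
count-cong zero    p≗q = refl
count-cong (suc n) p≗q =
  cong₂ _+_ (cong indicator (p≗q fzero)) (count-cong n (λ i → p≗q (fsuc i)))

count≡0⇒false : ∀ n (p : Fin n → Bool) → count n p ≡ 0 → ∀ i → p i ≡ false
count≡0⇒false (suc n) p count≡0 fzero    with p fzero
... | false = refl
count≡0⇒false (suc n) p count≡0 (fsuc i) with p fzero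
... | false = count≡0⇒false n _ count≡0 i

sumFin-has-zero⊎≥length : ∀ n (f : Fin n → ℕ) → (∃[ i ] f i ≡ 0) ⊎ (n ≤ sumFin n f)
sumFin-has-zero⊎≥length zero    f = inj₂ z≤n
sumFin-has-zero⊎≥length (suc n) f with f fzero in eq
... | zero  = inj₁ (fzero , eq)
... | suc x with sumFin-has-zero⊎≥length n (λ i → f (fsuc i))
...   | inj₁ (i , fi≡0) = inj₁ (fsuc i , fi≡0)
...   | inj₂ n≤sum      = inj₂ (s≤s (≤-trans n≤sum (m≤n+m _ x)))

<ᵇ≡false⇒≥ : ∀ m n → (m <ᵇ n) ≡ false → n ≤ m
<ᵇ≡false⇒≥ m n eq = ≮⇒≥ (λ m<n → subst T eq (<⇒<ᵇ m<n))

module _ (H : Graph) where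

  adjacentBefore : Fin (V H) → Fin (V H) → ℕ
  adjacentBefore i j = indicator ((toℕ i <ᵇ toℕ j) ∧ adj H i j)

  edges≡sumFin-adjacentBefore : edges H ≡ sumFin (V H) (λ i → sumFin (V H) (adjacentBefore i))
  edges≡sumFin-adjacentBefore = sumFin-cong (V H) (λ i → count≡sumFin-indicator (V H) _)

  adj≤adjacentBefore-either-way : ∀ i j →
    indicator (adj H i j) ≤ adjacentBefore i j + adjacentBefore j i
  adj≤adjacentBefore-either-way i j with toℕ i <ᵇ toℕ j in i<j | toℕ j <ᵇ toℕ i in j<i
  ... | true  | _    = m≤m+n _ _
  ... | false | true rewrite Graph.sym H j i = ≤-refl
  ... | false | false
    with refl ← toℕ-injective {i = i} {j = j} (≤-antisym (<ᵇ≡false⇒≥ _ _ j<i) (<ᵇ≡false⇒≥ _ _ i<j))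
    rewrite Graph.irrefl H i = z≤n

  handshake : sumFin (V H) (degree H) ≤ edges H + edges H
  handshake = begin
    sumFin n (λ i → count n (adj H i))
      ≡⟨ sumFin-cong n (λ i → count≡sumFin-indicator n (adj H i)) ⟩
    sumFin n (λ i → sumFin n (λ j → indicator (adj H i j)))
      ≤⟨ sumFin-mono-≤ n (λ i → sumFin-mono-≤ n (adj≤adjacentBefore-either-way i)) ⟩
    sumFin n (λ i → sumFin n (λ j → adjacentBefore i j + adjacentBefore j i))
      ≡⟨ sumFin-cong n (λ i → sumFin-distrib-+ n (adjacentBefore i) (λ j → adjacentBefore j i)) ⟩
    sumFin n (λ i → sumFin n (adjacentBefore i) + sumFin n (λ j → adjacentBefore j i))
      ≡⟨ sumFin-distrib-+ n _ _ ⟩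
    E + sumFin n (λ i → sumFin n (λ j → adjacentBefore j i))
      ≡⟨ cong (E +_) (sumFin-swap n n (λ i j → adjacentBefore j i)) ⟩
    E + E
      ≡⟨ sym (cong₂ _+_ edges≡sumFin-adjacentBefore edges≡sumFin-adjacentBefore) ⟩
    edges H + edges H ∎
    where
    open ≤-Reasoning
    n = V H
    E = sumFin n (λ i → sumFin n (adjacentBefore i))

inWindow : ℕ → ℕ → Bool
inWindow k d = ⌊ d ≟ k ⌋ ∨ ⌊ d ≟ k ∸ 1 ⌋

inWindow≡false : ∀ {k d} → d ≢ k → d ≢ k ∸ 1 → inWindow k d ≡ false
inWindow≡false {k} {d} d≢k d≢k-1 with d ≟ k | d ≟ k ∸ 1
... | yes d≡k | _          = contradiction d≡k d≢k
... | no _    | yes d≡k-1 = contradiction d≡k-1 d≢k-1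
... | no _    | no _      = refl

inWindow≡false⇒≢ : ∀ {k d} → inWindow k d ≡ false → (d ≢ k) × (d ≢ k ∸ 1)
inWindow≡false⇒≢ {k} {d} eq with d ≟ k | d ≟ k ∸ 1
inWindow≡false⇒≢ () | yes _ | _
inWindow≡false⇒≢ () | no _  | yes _
... | no d≢k | no d≢k-1 = d≢k , d≢k-1

inWindow⇒≤ : ∀ {k d} → inWindow k d ≡ true → d ≤ k
inWindow⇒≤ {k} {d} eq with d ≟ k | d ≟ k ∸ 1
... | yes d≡k | _         = ≤-reflexive d≡k
... | no _    | yes d≡k-1 = ≤-trans (≤-reflexive d≡k-1) (m∸n≤m k 1)
inWindow⇒≤ () | no _ | no _

windowHits : ℕ → (m : ℕ) → ℕ → Fin m → Bool
windowHits a m d j = inWindow (a + 2 * toℕ j) d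

count-windowHits-suc : ∀ a m d →
  count m (λ j → windowHits a (suc m) d (fsuc j)) ≡ count m (windowHits (a + 2) m d)
count-windowHits-suc a m d = count-cong m (λ j → cong (λ k → inWindow k d) (shift (toℕ j)))
  where
  shift : ∀ t → a + 2 * suc t ≡ a + 2 + 2 * t
  shift t = trans (cong (a +_) (*-suc 2 t)) (sym (+-assoc a 2 (2 * t)))

count-windowHits-below : ∀ a m d → suc d < a → count m (windowHits a m d) ≡ 0
count-windowHits-below a zero    d d+1<a = refl
count-windowHits-below a (suc m) d d+1<a = begin
  indicator (inWindow (a + 0) d) + count m (λ j → windowHits a (suc m) d (fsuc j))
    ≡⟨ cong₂ _+_ (cong indicator (inWindow≡false d≢a d≢a-1)) (count-windowHits-suc a m d) ⟩
  count m (windowHits (a + 2) m d)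
    ≡⟨ count-windowHits-below (a + 2) m d (≤-trans d+1<a (m≤m+n a 2)) ⟩
  0 ∎
  where
  open ≡-Reasoning
  d≢a : d ≢ a + 0
  d≢a d≡a = <-irrefl d≡a (≤-trans (<⇒≤ d+1<a) (m≤m+n a 0))
  d≢a-1 : d ≢ a + 0 ∸ 1
  d≢a-1 d≡a-1 = <-irrefl (trans d≡a-1 (cong (_∸ 1) (+-identityʳ a))) (∸-monoˡ-≤ 1 d+1<a)

count-windowHits-≤1 : ∀ a m d → count m (windowHits a m d) ≤ 1
count-windowHits-≤1 a zero    d = z≤n
count-windowHits-≤1 a (suc m) d with inWindow (a + 0) d in hit
... | false = subst (_≤ 1) (sym (count-windowHits-suc a m d)) (count-windowHits-≤1 (a + 2) m d)
... | true  = s≤s (≤-reflexive (trans (count-windowHits-suc a m d)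
                                      (count-windowHits-below (a + 2) m d d+1<a+2)))
  where
  d≤a : d ≤ a
  d≤a = ≤-trans (inWindow⇒≤ hit) (≤-reflexive (+-identityʳ a))
  d+1<a+2 : suc d < a + 2
  d+1<a+2 = subst (suc (suc d) ≤_) (+-comm 2 a) (s≤s (s≤s d≤a))

count-windowHits*≤ : ∀ a m d → count m (windowHits a m d) * (a ∸ 1) ≤ d
count-windowHits*≤ a m d with suc d <? a
... | yes d+1<a rewrite count-windowHits-below a m d d+1<a = z≤n
... | no  d+1≮a = begin
  count m (windowHits a m d) * (a ∸ 1) ≤⟨ *-monoˡ-≤ (a ∸ 1) (count-windowHits-≤1 a m d) ⟩
  1 * (a ∸ 1)                          ≡⟨ *-identityˡ (a ∸ 1) ⟩
  a ∸ 1                                ≤⟨ ∸-monoˡ-≤ 1 (≮⇒≥ d+1≮a) ⟩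
  d ∎
  where open ≤-Reasoning

module _ (H : Graph) (a m : ℕ) where

  blockers : Fin m → ℕ
  blockers j = count (V H) (λ v → windowHits a m (degree H v) j)

  sumFin-blockers*≤degree-sum : sumFin m blockers * (a ∸ 1) ≤ sumFin (V H) (degree H)
  sumFin-blockers*≤degree-sum = begin
    sumFin m blockers * c
      ≡⟨ sumFin-distribʳ-* m blockers c ⟩
    sumFin m (λ j → blockers j * c)
      ≡⟨ sumFin-cong m (λ j → trans (cong (_* c) (count≡sumFin-indicator n _))
                                    (sumFin-distribʳ-* n _ c)) ⟩
    sumFin m (λ j → sumFin n (λ v → hit v j * c))
      ≡⟨ sumFin-swap m n (λ j v → hit v j * c) ⟩
    sumFin n (λ v → sumFin m (λ j → hit v j * c))
      ≡⟨ sumFin-cong n (λ v → sym (trans (cong (_* c) (count≡sumFin-indicator m _))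
                                         (sumFin-distribʳ-* m _ c))) ⟩
    sumFin n (λ v → count m (windowHits a m (degree H v)) * c)
      ≤⟨ sumFin-mono-≤ n (λ v → count-windowHits*≤ a m (degree H v)) ⟩
    sumFin n (degree H) ∎
    where
    open ≤-Reasoning
    n = V H
    c = a ∸ 1
    hit : Fin n → Fin m → ℕ
    hit v j = indicator (windowHits a m (degree H v) j)

  unblocked-window : edges H + edges H < m * (a ∸ 1) →
    ∃[ j ] ((v : Fin (V H)) → (degree H v ≢ a + 2 * toℕ j) × (degree H v ≢ a + 2 * toℕ j ∸ 1))
  unblocked-window sparse with sumFin-has-zero⊎≥length m blockers
  ... | inj₁ (j , none) = j , λ v → inWindow≡false⇒≢ (count≡0⇒false (V H) _ none v)
  ... | inj₂ m≤sum = contradiction many-edges (<⇒≱ sparse)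
    where
    many-edges : m * (a ∸ 1) ≤ edges H + edges H
    many-edges = ≤-trans (*-monoˡ-≤ (a ∸ 1) m≤sum)
                         (≤-trans sumFin-blockers*≤degree-sum (handshake H))

^-distribʳ-* : ∀ m n o → (m * n) ^ o ≡ m ^ o * n ^ o
^-distribʳ-* m n zero    = refl
^-distribʳ-* m n (suc o) =
  trans (cong (m * n *_) (^-distribʳ-* m n o))
        (+-*-Solver.solve 4 (λ m n x y → m :* n :* (x :* y) := m :* x :* (n :* y))
                            refl m n (m ^ o) (n ^ o))
  where open +-*-Solver using (_:*_; _:=_)

∃-bracketing : (g : ℕ → ℕ) → g 0 ≡ 0 → (∀ s → g s < g (suc s)) →
               ∀ n → ∃[ s ] ((g s ≤ n) × (n < g (suc s)))
∃-bracketing g g0≡0 g-< zero = 0 , ≤-reflexive g0≡0 , subst (_< g 1) g0≡0 (g-< 0)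
∃-bracketing g g0≡0 g-< (suc n) with ∃-bracketing g g0≡0 g-< n
... | s , gs≤n , n<gs+1 with suc n <? g (suc s)
...   | yes n+1<gs+1 = s , m≤n⇒m≤1+n gs≤n , n+1<gs+1
...   | no  n+1≮gs+1 =
  suc s , ≤-reflexive (sym n+1≡gs+1) , subst (_< g (suc (suc s))) (sym n+1≡gs+1) (g-< (suc s))
  where
  n+1≡gs+1 : suc n ≡ g (suc s)
  n+1≡gs+1 = ≤-antisym n<gs+1 (≮⇒≥ n+1≮gs+1)

∃-root : ∀ e .{{_ : NonZero e}} n → ∃[ s ] ((s ^ e ≤ n) × (n < suc s ^ e))
∃-root e@(suc _) = ∃-bracketing (_^ e) refl (λ s → ^-monoˡ-< e (n<1+n s))

module Bounds (c s u : ℕ) (s<u : s < u) (u≤2s : u ≤ 2 * s)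
              (s≥4098 : 4098 ≤ s) (s>2²¹c : 2 ^ 21 * c < s) where

  instance
    s≢0 : NonZero s
    s≢0 = >-nonZero (≤-trans (s≤s z≤n) s≥4098)

  a : ℕ
  a = u ^ 12

  u^e≤2^e*s^e : ∀ e → u ^ e ≤ 2 ^ e * s ^ e
  u^e≤2^e*s^e e = ≤-trans (^-monoˡ-≤ e u≤2s) (≤-reflexive (^-distribʳ-* 2 s e))

  n³≤k⁵ : ∀ {n k} → n ≤ u ^ 20 → a ≤ k → n ^ 3 ≤ k ^ 5
  n³≤k⁵ {n} {k} n≤ a≤k = begin
    n ^ 3            ≤⟨ ^-monoˡ-≤ 3 n≤ ⟩
    (u ^ 20) ^ 3 ≡⟨ ^-*-assoc u 20 3 ⟩
    u ^ 60       ≡⟨ sym (^-*-assoc u 12 5) ⟩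
    a ^ 5            ≤⟨ ^-monoˡ-≤ 5 a≤k ⟩
    k ^ 5 ∎
    where open ≤-Reasoning

  k¹⁰≤n⁷ : ∀ {n k} → s ^ 20 ≤ n → k ≤ s ^ 14 → k ^ 10 ≤ n ^ 7
  k¹⁰≤n⁷ {n} {k} ≤n k≤ = begin
    k ^ 10         ≤⟨ ^-monoˡ-≤ 10 k≤ ⟩
    (s ^ 14) ^ 10  ≡⟨ ^-*-assoc s 14 10 ⟩
    s ^ 140        ≡⟨ sym (^-*-assoc s 20 7) ⟩
    (s ^ 20) ^ 7   ≤⟨ ^-monoˡ-≤ 7 ≤n ⟩
    n ^ 7 ∎
    where open ≤-Reasoning

  windows≤s¹⁴ : a + 2 * s ^ 13 ≤ s ^ 14
  windows≤s¹⁴ = begin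
    a + 2 * s ^ 13               ≤⟨ +-monoˡ-≤ (2 * s ^ 13) (u^e≤2^e*s^e 12) ⟩
    2 ^ 12 * s ^ 12 + 2 * s ^ 13 ≤⟨ +-monoˡ-≤ (2 * s ^ 13) (*-monoʳ-≤ (2 ^ 12) (m≤n*m (s ^ 12) s)) ⟩
    2 ^ 12 * s ^ 13 + 2 * s ^ 13 ≡⟨ sym (*-distribʳ-+ (s ^ 13) (2 ^ 12) 2) ⟩
    (2 ^ 12 + 2) * s ^ 13        ≤⟨ *-monoˡ-≤ (s ^ 13) s≥4098 ⟩
    s * s ^ 13 ∎
    where open ≤-Reasoning

  few-edges : ∀ {n} → n ≤ u ^ 20 → c * n + c * n < s ^ 13 * (a ∸ 1)
  few-edges {n} n≤ = begin-strict
    c * n + c * n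
      ≤⟨ +-mono-≤ (*-monoʳ-≤ c n≤′) (*-monoʳ-≤ c n≤′) ⟩
    c * (2 ^ 20 * s ^ 20) + c * (2 ^ 20 * s ^ 20)
      ≡⟨ +-*-Solver.solve 3 (λ c K t → c :* (K :* t) :+ c :* (K :* t) := con 2 :* K :* c :* t)
                            refl c (2 ^ 20) (s ^ 20) ⟩
    2 ^ 21 * c * s ^ 20
      <⟨ *-monoˡ-< (s ^ 20) {{m^n≢0 s 20}} (≤-trans s>2²¹c (m≤m*n s (s ^ 4) {{m^n≢0 s 4}})) ⟩
    s ^ 5 * s ^ 20
      ≡⟨ sym (^-distribˡ-+-* s 5 20) ⟩
    s ^ 25
      ≡⟨ ^-distribˡ-+-* s 13 12 ⟩
    s ^ 13 * s ^ 12
      ≤⟨ *-monoʳ-≤ (s ^ 13) (∸-monoˡ-≤ 1 (^-monoˡ-< 12 s<u)) ⟩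
    s ^ 13 * (a ∸ 1) ∎
    where
    open ≤-Reasoning
    open +-*-Solver using (_:+_; _:*_; _:=_; con)
    n≤′ : n ≤ 2 ^ 20 * s ^ 20
    n≤′ = ≤-trans n≤ (u^e≤2^e*s^e 20)

  good-degree : ∀ {n} (H : Graph) → edges H ≤ c * n → s ^ 20 ≤ n → n < u ^ 20 →
    ∃[ k ] ((n ^ 3 ≤ k ^ 5) × (k ^ 10 ≤ n ^ 7) ×
            ((v : Fin (V H)) → (degree H v ≢ k) × (degree H v ≢ k ∸ 1)))
  good-degree {n} H edges≤ s²⁰≤n n<u²⁰ =
    let j , unblocked = unblocked-window H a (s ^ 13) two-edges<
        k = a + 2 * toℕ j
        k≤s¹⁴ = ≤-trans (+-monoʳ-≤ a (*-monoʳ-≤ 2 (<⇒≤ (toℕ<n j)))) windows≤s¹⁴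
    in k , n³≤k⁵ (<⇒≤ n<u²⁰) (m≤m+n a _) , k¹⁰≤n⁷ s²⁰≤n k≤s¹⁴ , unblocked
    where
    two-edges< : edges H + edges H < s ^ 13 * (a ∸ 1)
    two-edges< = ≤-<-trans (+-mono-≤ edges≤ edges≤) (few-edges (<⇒≤ n<u²⁰))

^-cancelʳ-< : ∀ e {m n} → m ^ e < n ^ e → m < n
^-cancelʳ-< e mᵉ<nᵉ = ≰⇒> (λ n≤m → <⇒≱ mᵉ<nᵉ (^-monoˡ-≤ e n≤m))

1+m≤2*m : ∀ {m} → 1 ≤ m → suc m ≤ 2 * m
1+m≤2*m {m} 1≤m = ≤-trans (+-monoˡ-≤ m 1≤m) (≤-reflexive (cong (m +_) (sym (+-identityʳ m))))

lemma2 : (c₀ : ℕ) → ∃[ N ] ((n : ℕ) → N ≤ n → (H : Graph) →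
           nodes H ≤ c₀ * n → edges H ≤ c₀ * n →
           ∃[ k ] ((n ^ 3 ≤ k ^ 5) × (k ^ 10 ≤ n ^ 7) ×
                   ((v : Fin (V H)) → (degree H v ≢ k) × (degree H v ≢ k ∸ 1))))
lemma2 c₀ = s₀ ^ 20 , λ n s₀²⁰≤n H _ edges≤ →
  let s , s²⁰≤n , n<⟨s+1⟩²⁰ = ∃-root 20 n
      s₀≤s = s≤s⁻¹ (^-cancelʳ-< 20 {s₀} {suc s} (≤-<-trans s₀²⁰≤n n<⟨s+1⟩²⁰))
      s≥4098 = s₀≤⇒4098≤ s₀≤s
  in Bounds.good-degree c₀ s (suc s) (n<1+n s) (1+m≤2*m (≤-trans (s≤s z≤n) s≥4098))
                        s≥4098 (s₀≤⇒2²¹c₀< s₀≤s) H edges≤ s²⁰≤n n<⟨s+1⟩²⁰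
  where
  s₀ : ℕ
  s₀ = 2 ^ 21 * c₀ + 4098
  s₀≤⇒4098≤ : ∀ {s} → s₀ ≤ s → 4098 ≤ s
  s₀≤⇒4098≤ = ≤-trans (m≤n+m 4098 (2 ^ 21 * c₀))
  s₀≤⇒2²¹c₀< : ∀ {s} → s₀ ≤ s → 2 ^ 21 * c₀ < s
  s₀≤⇒2²¹c₀< = <-≤-trans (m<m+n (2 ^ 21 * c₀) {4098} (s≤s z≤n))
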